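{- Let $\pi_1,\pi_2$ be permutations of $\{1,\dots,n\}$ avoiding the pattern $312$. Then the following are equivalent: (a) for every $1\leq k\leq n$, $|i_{\pi_1}(k)|\geq|i_{\pi_2}(k)|$; (b) for every $1\leq k\leq n$, $\max_{\pi_1}(k)\leq\max_{\pi_2}(k)$.
   Context: A permutation $\pi=\pi(1)\pi(2)\cdots\pi(n)$ avoids $312$ if there are no indices $a<b<c$ with $\pi(b)<\pi(c)<\pi(a)$. For an entry $a$ of $\pi$, $i_\pi(a)$ is the set of entries of $\pi$ that are smaller than $a$ and appear before $a$ in $\pi$. The vector $\max_\pi$ is defined by $\max_\pi(k)=\max\{\pi(i): i\leq k\}$. -}

module Defs where

open import Data.Nat using (ℕ; zero; suc)
open import Data.Fin using (Fin; zero; suc; _<_; _≤_; _<?_; _≤?_)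
open import Data.Fin.Permutation using (Permutation′; _⟨$⟩ʳ_; _⟨$⟩ˡ_)
open import Data.List using (List; length; filter; foldr)
open import Data.List.Base using () renaming (allFin to allFinL)
open import Data.Product using (_×_)
open import Relation.Nullary using (¬_)
open import Relation.Nullary.Decidable using (_×-dec_)

-- A permutation of {1,…,n} is a bijection Fin n ↔ Fin n; value/position
-- j : Fin n stands for j+1 (order preserving shift).
-- π(i) = π ⟨$⟩ʳ i ; position of the entry a is π ⟨$⟩ˡ a.

Avoids312 : {n : ℕ} → Permutation′ n → Set
Avoids312 {n} π =
  ∀ (a b c : Fin n) → a < b → b < c →
    ¬ ((π ⟨$⟩ʳ b) < (π ⟨$⟩ʳ c) × (π ⟨$⟩ʳ c) < (π ⟨$⟩ʳ a))

iSet : {n : ℕ} → Permutation′ n → Fin n → List (Fin n)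
iSet {n} π a =
  filter (λ j → (j <? a) ×-dec ((π ⟨$⟩ˡ j) <? (π ⟨$⟩ˡ a))) (allFinL n)

iCard : {n : ℕ} → Permutation′ n → Fin n → ℕ
iCard π a = length (iSet π a)

maxF : {n : ℕ} → Fin n → Fin n → Fin n
maxF a b with a <? b
... | Relation.Nullary.yes _ = b
... | Relation.Nullary.no _ = a

-- max_π(k) = max { π(i) : i ≤ k }  (prefix maximum): fold maxF over the
-- values π(i) for the positions i ≤ k, starting from π(k) (which is in the set).
maxPrefix : {n : ℕ} → Permutation′ n → Fin n → Fin n
maxPrefix {n} π k =
  foldr (λ i m → maxF (π ⟨$⟩ʳ i) m) (π ⟨$⟩ʳ k) (filter (λ i → i ≤? k) (allFinL n))

-- Write M for the prefix-maximum vector of π and p(v) for the position of the entry v.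
-- If π avoids 312, an entry j < v lies in i_π(v) exactly when M(p(j)) < v: a larger
-- entry before p(j) would form a 312 with j and v. Re-indexing by positions,
-- |i_π(v)| = #{k : M(k) < v}. Hence (b) ⇒ (a) is immediate, and conversely if
-- M₂(t) < v := M₁(t), then, M being monotone, {k : M₁(k) < v} ⊊ {k : M₂(k) < v}
-- (the position t is in the second set only), so |i_π₁(v)| < |i_π₂(v)|.
module Submission where

open import Defs
open import Data.Nat using (ℕ; zero; suc; _≥_; z≤n) renaming (_≤_ to _≤ℕ_; _<_ to _<ℕ_)
import Data.Nat.Properties as ℕ
open import Data.Fin using (Fin; zero; suc; _≤_; _<_)
open import Data.Fin.Properties using (_<?_; _≤?_; <-cmp; ≤∧≢⇒<; <-irrefl)
open import Data.Fin.Permutation using (Permutation′; _⟨$⟩ʳ_; _⟨$⟩ˡ_; inverseˡ; inverseʳ; flip)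
open import Data.Product using (_×_; _,_; proj₂; ∃)
open import Data.Sum using (_⊎_; inj₁; inj₂)
open import Data.List using (List; []; _∷_; length; filter; foldr; tabulate)
open import Data.List.Base using () renaming (allFin to allFinL)
open import Data.List.Membership.Propositional using (_∈_)
open import Data.List.Membership.Propositional.Properties using (∈-filter⁺; ∈-filter⁻; ∈-allFin)
open import Data.List.Relation.Unary.Any using (here; there)
open import Level using (0ℓ)
open import Function using (_∘_; id)
open import Function.Bundles using (_⇔_; mk⇔; Equivalence)
open import Relation.Binary.Definitions using (tri<; tri≈; tri>)
open import Relation.Binary.PropositionalEquality using (_≡_; refl; sym; trans; cong; subst; subst₂; module ≡-Reasoning)
open import Relation.Nullary using (Dec; yes; no; ¬_; contradiction)
open import Relation.Nullary.Decidable using (_×-dec_)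
open import Relation.Unary using (Pred; Decidable; _⊆_)
open import Algebra.Properties.CommutativeMonoid.Sum ℕ.+-0-commutativeMonoid using (sum; sum-cong-≗; sum-permute)

indicator : {P : Set} → Dec P → ℕ
indicator (yes _) = 1
indicator (no _)  = 0

indicator-mono : {P Q : Set} → (P → Q) → (P? : Dec P) (Q? : Dec Q) → indicator P? ≤ℕ indicator Q?
indicator-mono P⇒Q (yes _) (yes _) = ℕ.≤-refl
indicator-mono P⇒Q (yes p) (no ¬q) = contradiction (P⇒Q p) ¬q
indicator-mono P⇒Q (no _)  _       = z≤n

indicator-strict : {P Q : Set} → ¬ P → Q → (P? : Dec P) (Q? : Dec Q) → indicator P? <ℕ indicator Q?
indicator-strict ¬p q (yes p) _        = contradiction p ¬p
indicator-strict ¬p q (no _)  (yes _)  = ℕ.≤-refl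
indicator-strict ¬p q (no _)  (no ¬q)  = contradiction q ¬q

count : {n : ℕ} {P : Pred (Fin n) 0ℓ} → Decidable P → ℕ
count P? = sum (indicator ∘ P?)

length-filter-tabulate : {A : Set} {P : Pred A 0ℓ} (P? : Decidable P) (n : ℕ) (f : Fin n → A) →
  length (filter P? (tabulate f)) ≡ count (P? ∘ f)
length-filter-tabulate P? zero    f = refl
length-filter-tabulate P? (suc n) f with P? (f zero)
... | yes _ = cong suc (length-filter-tabulate P? n (f ∘ suc))
... | no _  = length-filter-tabulate P? n (f ∘ suc)

module _ {n : ℕ} {P Q : Pred (Fin n) 0ℓ} (P? : Decidable P) (Q? : Decidable Q) where

  count-mono : P ⊆ Q → count P? ≤ℕ count Q?
  count-mono P⊆Q = sum-mono n (indicator ∘ P?) (indicator ∘ Q?) (λ i → indicator-mono P⊆Q (P? i) (Q? i))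
    where
    sum-mono : ∀ m (f g : Fin m → ℕ) → (∀ i → f i ≤ℕ g i) → sum f ≤ℕ sum g
    sum-mono zero    f g f≤g = z≤n
    sum-mono (suc m) f g f≤g = ℕ.+-mono-≤ (f≤g zero) (sum-mono m (f ∘ suc) (g ∘ suc) (f≤g ∘ suc))

  count-cong : (∀ i → P i ⇔ Q i) → count P? ≡ count Q?
  count-cong P⇔Q = sum-cong-≗ λ i →
    ℕ.≤-antisym (indicator-mono (Equivalence.to (P⇔Q i)) (P? i) (Q? i))
                (indicator-mono (Equivalence.from (P⇔Q i)) (Q? i) (P? i))

count-strict : ∀ {n} {P Q : Pred (Fin n) 0ℓ} (P? : Decidable P) (Q? : Decidable Q) →
  P ⊆ Q → (t : Fin n) → ¬ P t → Q t → count P? <ℕ count Q?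
count-strict P? Q? P⊆Q zero ¬Pt Qt =
  ℕ.+-mono-<-≤ (indicator-strict ¬Pt Qt (P? zero) (Q? zero)) (count-mono (P? ∘ suc) (Q? ∘ suc) P⊆Q)
count-strict P? Q? P⊆Q (suc t) ¬Pt Qt =
  ℕ.+-mono-≤-< (indicator-mono P⊆Q (P? zero) (Q? zero)) (count-strict (P? ∘ suc) (Q? ∘ suc) P⊆Q t ¬Pt Qt)

count-permute : ∀ {n} {P : Pred (Fin n) 0ℓ} (P? : Decidable P) (σ : Permutation′ n) →
  count P? ≡ count (P? ∘ (σ ⟨$⟩ʳ_))
count-permute P? σ = sum-permute (indicator ∘ P?) σ

module _ {n : ℕ} where

  maxF-≥ˡ : (a b : Fin n) → a ≤ maxF a b
  maxF-≥ˡ a b with a <? b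
  ... | yes a<b = ℕ.<⇒≤ a<b
  ... | no _    = ℕ.≤-refl

  maxF-≥ʳ : (a b : Fin n) → b ≤ maxF a b
  maxF-≥ʳ a b with a <? b
  ... | yes _   = ℕ.≤-refl
  ... | no a≮b  = ℕ.≮⇒≥ a≮b

  maxF-sel : (a b : Fin n) → maxF a b ≡ a ⊎ maxF a b ≡ b
  maxF-sel a b with a <? b
  ... | yes _ = inj₂ refl
  ... | no _  = inj₁ refl

  module _ (g : Fin n → Fin n) (x₀ : Fin n) where

    foldMax : List (Fin n) → Fin n
    foldMax = foldr (λ i m → maxF (g i) m) x₀

    foldMax-≥-∈ : ∀ {i} is → i ∈ is → g i ≤ foldMax is
    foldMax-≥-∈ (j ∷ is) (here refl) = maxF-≥ˡ (g j) (foldMax is)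
    foldMax-≥-∈ (j ∷ is) (there i∈is) = ℕ.≤-trans (foldMax-≥-∈ is i∈is) (maxF-≥ʳ (g j) (foldMax is))

    foldMax-attained : ∀ is → foldMax is ≡ x₀ ⊎ ∃ λ i → i ∈ is × foldMax is ≡ g i
    foldMax-attained []       = inj₁ refl
    foldMax-attained (j ∷ is) with maxF-sel (g j) (foldMax is)
    ... | inj₁ e = inj₂ (j , here refl , e)
    ... | inj₂ e with foldMax-attained is
    ...   | inj₁ e′              = inj₁ (trans e e′)
    ...   | inj₂ (i , i∈is , e′) = inj₂ (i , there i∈is , trans e e′)

module _ {n : ℕ} (π : Permutation′ n) where

  private
    positionsUpTo : Fin n → List (Fin n)
    positionsUpTo t = filter (_≤? t) (allFinL n)

  ≤-maxPrefix : ∀ {s t} → s ≤ t → π ⟨$⟩ʳ s ≤ maxPrefix π t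
  ≤-maxPrefix {s} {t} s≤t =
    foldMax-≥-∈ (π ⟨$⟩ʳ_) (π ⟨$⟩ʳ t) (positionsUpTo t) (∈-filter⁺ (_≤? t) (∈-allFin s) s≤t)

  maxPrefix-attained : ∀ t → ∃ λ s → s ≤ t × maxPrefix π t ≡ π ⟨$⟩ʳ s
  maxPrefix-attained t with foldMax-attained (π ⟨$⟩ʳ_) (π ⟨$⟩ʳ t) (positionsUpTo t)
  ... | inj₁ e = t , ℕ.≤-refl , e
  ... | inj₂ (s , s∈ , e) = s , proj₂ (∈-filter⁻ (_≤? t) {xs = allFinL n} s∈) , e

  maxPrefix-mono : ∀ {s t} → s ≤ t → maxPrefix π s ≤ maxPrefix π t
  maxPrefix-mono {s} s≤t with maxPrefix-attained s
  ... | s′ , s′≤s , e rewrite e = ≤-maxPrefix (ℕ.≤-trans s′≤s s≤t)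

  maxPrefix<⇒ : ∀ {v s} → maxPrefix π s < v → π ⟨$⟩ʳ s < v × s < π ⟨$⟩ˡ v
  maxPrefix<⇒ {v} {s} Ms<v = ℕ.≤-<-trans (≤-maxPrefix ℕ.≤-refl) Ms<v , ℕ.≰⇒> pv≰s
    where
    pv≰s : ¬ (π ⟨$⟩ˡ v ≤ s)
    pv≰s pv≤s = ℕ.<-irrefl refl
      (ℕ.≤-<-trans (subst (_≤ maxPrefix π s) (inverseʳ π) (≤-maxPrefix pv≤s)) Ms<v)

  -- The maximum of the prefix ending at s sits at some s′ ≤ s; if it exceeded v,
  -- the positions s′ < s < p(v) would carry a 312.
  <⇒maxPrefix< : Avoids312 π → ∀ {v s} → π ⟨$⟩ʳ s < v → s < π ⟨$⟩ˡ v → maxPrefix π s < v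
  <⇒maxPrefix< avoids {v} {s} πs<v s<pv with maxPrefix-attained s
  ... | s′ , s′≤s , e rewrite e with <-cmp (π ⟨$⟩ʳ s′) v
  ... | tri< πs′<v _ _ = πs′<v
  ... | tri≈ _ πs′≡v _ =
    contradiction (ℕ.≤-<-trans s′≤s s<pv) (<-irrefl (trans (sym (inverseˡ π)) (cong (π ⟨$⟩ˡ_) πs′≡v)))
  ... | tri> _ _ v<πs′ =
    contradiction (subst (π ⟨$⟩ʳ s <_) (sym (inverseʳ π)) πs<v , subst (_< π ⟨$⟩ʳ s′) (sym (inverseʳ π)) v<πs′)
                  (avoids s′ s (π ⟨$⟩ˡ v) s′<s s<pv)
    where
    s′<s : s′ < s
    s′<s = ≤∧≢⇒< s′≤s λ s′≡s → ℕ.<-asym πs<v (subst (λ x → v < π ⟨$⟩ʳ x) s′≡s v<πs′)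

  iCard≡count-maxPrefix< : Avoids312 π → ∀ v → iCard π v ≡ count (λ s → maxPrefix π s <? v)
  iCard≡count-maxPrefix< avoids v = begin
    iCard π v                                   ≡⟨ length-filter-tabulate inSet n id ⟩
    count inSet                                 ≡⟨ count-cong inSet (λ j → maxPrefix π (π ⟨$⟩ˡ j) <? v) inSet⇔ ⟩
    count (λ j → maxPrefix π (π ⟨$⟩ˡ j) <? v)   ≡⟨ count-permute (λ s → maxPrefix π s <? v) (flip π) ⟨
    count (λ s → maxPrefix π s <? v)            ∎
    where
    open ≡-Reasoning
    inSet : Decidable (λ j → j < v × π ⟨$⟩ˡ j < π ⟨$⟩ˡ v)
    inSet j = (j <? v) ×-dec (π ⟨$⟩ˡ j <? π ⟨$⟩ˡ v)
    inSet⇔ : ∀ j → (j < v × π ⟨$⟩ˡ j < π ⟨$⟩ˡ v) ⇔ maxPrefix π (π ⟨$⟩ˡ j) < v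
    inSet⇔ j = mk⇔ (λ (j<v , pj<pv) → <⇒maxPrefix< avoids (subst (_< v) (sym (inverseʳ π)) j<v) pj<pv)
                   (λ M<v → let (πpj<v , pj<pv) = maxPrefix<⇒ M<v in subst (_< v) (inverseʳ π) πpj<v , pj<pv)

module _ {n : ℕ} (π₁ π₂ : Permutation′ n) (avoids₁ : Avoids312 π₁) (avoids₂ : Avoids312 π₂) where

  maxPrefix≤⇒iCard≥ : (∀ k → maxPrefix π₁ k ≤ maxPrefix π₂ k) → ∀ v → iCard π₁ v ≥ iCard π₂ v
  maxPrefix≤⇒iCard≥ M₁≤M₂ v =
    subst₂ _≤ℕ_ (sym (iCard≡count-maxPrefix< π₂ avoids₂ v)) (sym (iCard≡count-maxPrefix< π₁ avoids₁ v))
      (count-mono (λ s → maxPrefix π₂ s <? v) (λ s → maxPrefix π₁ s <? v) (ℕ.≤-<-trans (M₁≤M₂ _)))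

  iCard≥⇒maxPrefix≤ : (∀ v → iCard π₁ v ≥ iCard π₂ v) → ∀ k → maxPrefix π₁ k ≤ maxPrefix π₂ k
  iCard≥⇒maxPrefix≤ iCard₁≥iCard₂ t with maxPrefix π₁ t ≤? maxPrefix π₂ t
  ... | yes M₁t≤M₂t = M₁t≤M₂t
  ... | no M₁t≰M₂t  = contradiction (iCard₁≥iCard₂ v) (ℕ.<⇒≱ iCard₁<iCard₂)
    where
    v : Fin n
    v = maxPrefix π₁ t
    below₁⊆below₂ : (λ s → maxPrefix π₁ s < v) ⊆ (λ s → maxPrefix π₂ s < v)
    below₁⊆below₂ {s} M₁s<v = ℕ.≤-<-trans (maxPrefix-mono π₂ (ℕ.<⇒≤ s<t)) (ℕ.≰⇒> M₁t≰M₂t)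
      where
      s<t : s < t
      s<t = ℕ.≰⇒> λ t≤s → ℕ.<⇒≱ M₁s<v (maxPrefix-mono π₁ t≤s)
    iCard₁<iCard₂ : iCard π₁ v <ℕ iCard π₂ v
    iCard₁<iCard₂ =
      subst₂ _<ℕ_ (sym (iCard≡count-maxPrefix< π₁ avoids₁ v)) (sym (iCard≡count-maxPrefix< π₂ avoids₂ v))
        (count-strict (λ s → maxPrefix π₁ s <? v) (λ s → maxPrefix π₂ s <? v) below₁⊆below₂ t
          (ℕ.n≮n _) (ℕ.≰⇒> M₁t≰M₂t))

mainTheorem12 : (n : ℕ) (π₁ π₂ : Permutation′ n) →
    Avoids312 π₁ → Avoids312 π₂ →
    ((∀ (k : Fin n) → iCard π₁ k ≥ iCard π₂ k)
    ⇔ (∀ (k : Fin n) → maxPrefix π₁ k ≤ maxPrefix π₂ k))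
mainTheorem12 n π₁ π₂ avoids₁ avoids₂ =
  mk⇔ (iCard≥⇒maxPrefix≤ π₁ π₂ avoids₁ avoids₂) (maxPrefix≤⇒iCard≥ π₁ π₂ avoids₁ avoids₂)
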